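{- Let $R$ be a rank 2 subsystem of $\Phi$ not containing the simple root $\alpha_i$, and suppose $\gamma$ and $\delta$ are the fundamental roots of $R$. Then $s_i\gamma$ and $s_i\delta$ are the fundamental roots of the rank 2 subsystem $s_iR$.
   Context: $\Phi\subset V$ is the root system of a crystallographic Cartan matrix for a Coxeter group $W$: $V$ has basis of simple roots $\alpha_i$, $W$ acts by $s_i(\beta)=\beta-(\alpha_i,\beta)\alpha_i$ where $(\alpha_i,\alpha_j)=A_{ij}$, $\Phi$ is the union of $W$-orbits of simple roots, and every root has all coefficients $\ge0$ (positive roots) or all $\le0$. $V^*$ is the dual space; for $\gamma\in V$, $\gamma^\perp=\{f\in V^*: f(\gamma)=0\}$. The base region is $D=\{f\in V^*: f(\alpha_i)>0\text{ for all }i\}$. A rank 2 subsystem is $R=\Phi\cap U$ for a 2-dimensional subspace $U$ spanned by roots. The hyperplanes $\varepsilon^\perp$, $\varepsilon\in R$, form a rank 2 arrangement; the region of this arrangement containing $D$ is bounded by two of these hyperplanes (the basic hyperplanes), and the fundamental roots of $R$ are the two positive roots of $R$ whose hyperplanes are the basic ones. -}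

module Defs where

open import Data.Nat using (ℕ; zero; suc)
open import Data.Fin using (Fin; zero; suc)
open import Data.Integer using (ℤ; +_; _+_; _-_; _*_; _≤_; _<_; 0ℤ)
open import Data.List using (List; []; _∷_)
open import Data.Product using (Σ; ∃; _×_; _,_)
open import Data.Sum using (_⊎_)
open import Relation.Binary.PropositionalEquality using (_≡_; _≢_)
open import Relation.Nullary using (¬_)

-- Vectors of V = span of the simple roots, in coordinates w.r.t. the simple roots.
-- (Roots have integer coordinates.)
Vect : ℕ → Set
Vect n = Fin n → ℤ

_≈_ : ∀ {n} → Vect n → Vect n → Set
u ≈ v = ∀ j → u j ≡ v j

infix 4 _≈_

sumF : ∀ {n} → (Fin n → ℤ) → ℤ
sumF {zero}  f = 0ℤ
sumF {suc n} f = f zero + sumF (λ j → f (suc j))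

simple : ∀ {n} → Fin n → Vect n
simple zero    zero    = + 1
simple zero    (suc j) = 0ℤ
simple (suc i) zero    = 0ℤ
simple (suc i) (suc j) = simple i j

record CartanMatrix (n : ℕ) : Set where
  field
    A       : Fin n → Fin n → ℤ
    diag    : ∀ i → A i i ≡ + 2
    offdiag : ∀ i j → i ≢ j → A i j ≤ 0ℤ
    zeroSym : ∀ i j → A i j ≡ 0ℤ → A j i ≡ 0ℤ

module _ {n : ℕ} (C : CartanMatrix n) where
  open CartanMatrix C

  -- (α_i , β) extended linearly in β from (α_i, α_j) = A i j
  pairing : Fin n → Vect n → ℤ
  pairing i β = sumF (λ j → A i j * β j)

  refl' : Fin n → Vect n → Vect n
  refl' i β j = β j - pairing i β * simple i j

  act : List (Fin n) → Vect n → Vect n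
  act []       β = β
  act (i ∷ w)  β = refl' i (act w β)

  -- Φ = union of W-orbits of simple roots.
  IsRoot : Vect n → Set
  IsRoot β = Σ (List (Fin n)) λ w → Σ (Fin n) λ i → act w (simple i) ≈ β

  IsPositive : Vect n → Set
  IsPositive β = ∀ j → 0ℤ ≤ β j

  IsNegative : Vect n → Set
  IsNegative β = ∀ j → β j ≤ 0ℤ

  -- Linear independence (over ℚ, equivalently over ℤ) of two vectors.
  LinIndep : Vect n → Vect n → Set
  LinIndep u v = ∀ (a b : ℤ) → (∀ j → a * u j + b * v j ≡ 0ℤ) → (a ≡ 0ℤ) × (b ≡ 0ℤ)

  -- ε lies in the (rational) span U of u and v.
  InSpan : Vect n → Vect n → Vect n → Set
  InSpan u v ε = Σ ℤ λ c → Σ ℤ λ a → Σ ℤ λ b →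
                   (c ≢ 0ℤ) × (∀ j → c * ε j ≡ a * u j + b * v j)

  -- Rank 2 subsystem R = Φ ∩ U where U is spanned by the roots u, v.
  InSub : Vect n → Vect n → Vect n → Set
  InSub u v ε = IsRoot ε × InSpan u v ε

  -- Evaluation of a functional f ∈ V* (in dual coordinates) on a vector.
  eval : Vect n → Vect n → ℤ
  eval f β = sumF (λ j → f j * β j)

  -- γ is a fundamental root of R = Φ ∩ span(u,v): γ is a positive root of R and
  -- the hyperplane γ^⊥ is a wall (basic hyperplane) of the region of the
  -- arrangement {ε^⊥ : ε ∈ R} containing D, i.e. some f ∈ γ^⊥ is strictly
  -- positive on every other positive root of R.
  IsFundamental : Vect n → Vect n → Vect n → Set
  IsFundamental u v γ =
    InSub u v γ × IsPositive γ ×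
    Σ (Vect n) λ f → (eval f γ ≡ 0ℤ) ×
      (∀ ε → InSub u v ε → IsPositive ε → ¬ (ε ≈ γ) → 0ℤ < eval f ε)

-- s_i permutes Φ and maps span(β₁, β₂) onto span(s_i β₁, s_i β₂), so it carries R bijectively
-- onto s_i R. Since α_i ∉ R, the only positive root made negative by s_i (namely α_i) is not in
-- R, so s_i also maps the positive roots of R onto those of s_i R. Finally a functional f
-- witnessing that γ^⊥ is a wall of the region of D is transported to f ∘ s_i, which witnesses
-- that (s_i γ)^⊥ is a wall for s_i R. Applying the same argument to s_i R and s_i (an
-- involution) shows that no other root of s_i R is fundamental.
module Submission where

open import Data.Empty using (⊥-elim)
open import Data.Fin using (Fin; zero; suc)
import Data.Fin.Properties as Fin
open import Data.Integer using (ℤ; +_; _+_; _-_; _*_; -_; _≤_; _<_; 0ℤ)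
import Data.Integer.Properties as ℤ
open import Data.Integer.Tactic.RingSolver using (solve-∀)
open import Data.List using ([]; _∷_)
open import Data.Nat using (ℕ; zero; suc)
open import Data.Product using (_×_; _,_; proj₂)
open import Data.Sum using (_⊎_; inj₁; inj₂)
import Data.Sum as Sum
open import Function using (_∘_)
open import Relation.Binary.PropositionalEquality
open import Relation.Nullary using (¬_; yes; no)

open import Defs

sumF-cong : ∀ {n} {f g : Fin n → ℤ} → (∀ j → f j ≡ g j) → sumF f ≡ sumF g
sumF-cong {zero}  _ = refl
sumF-cong {suc n} f≗g = cong₂ _+_ (f≗g zero) (sumF-cong (f≗g ∘ suc))

sumF-zero : ∀ {n} {f : Fin n → ℤ} → (∀ j → f j ≡ 0ℤ) → sumF f ≡ 0ℤ
sumF-zero {zero}  _ = refl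
sumF-zero {suc n} f≗0 = cong₂ _+_ (f≗0 zero) (sumF-zero (f≗0 ∘ suc))

sumF-linear : ∀ {n} a b (f g : Fin n → ℤ) →
              sumF (λ j → a * f j + b * g j) ≡ a * sumF f + b * sumF g
sumF-linear {zero}  a b f g = sym (cong₂ _+_ (ℤ.*-zeroʳ a) (ℤ.*-zeroʳ b))
sumF-linear {suc n} a b f g =
  trans (cong (_+_ (a * f zero + b * g zero)) (sumF-linear a b (f ∘ suc) (g ∘ suc)))
        (interchange a b (f zero) (g zero) _ _)
  where
  interchange : ∀ a b x y u v →
                (a * x + b * y) + (a * u + b * v) ≡ a * (x + u) + b * (y + v)
  interchange = solve-∀

simple-diag : ∀ {n} (i : Fin n) → simple i i ≡ + 1
simple-diag zero    = refl
simple-diag (suc i) = simple-diag i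

simple-offdiag : ∀ {n} {i j : Fin n} → i ≢ j → simple i j ≡ 0ℤ
simple-offdiag {i = zero}  {zero}  i≢j = ⊥-elim (i≢j refl)
simple-offdiag {i = zero}  {suc j} _   = refl
simple-offdiag {i = suc i} {zero}  _   = refl
simple-offdiag {i = suc i} {suc j} i≢j = simple-offdiag (i≢j ∘ cong suc)

sumF-simple : ∀ {n} (g : Fin n → ℤ) i → sumF (λ j → g j * simple i j) ≡ g i
sumF-simple {suc n} g zero = begin
  g zero * + 1 + sumF (λ j → g (suc j) * 0ℤ) ≡⟨ cong₂ _+_ (ℤ.*-identityʳ (g zero))
                                                         (sumF-zero (ℤ.*-zeroʳ ∘ g ∘ suc)) ⟩
  g zero + 0ℤ                                 ≡⟨ ℤ.+-identityʳ (g zero) ⟩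
  g zero                                      ∎
  where open ≡-Reasoning
sumF-simple {suc n} g (suc i) =
  trans (cong (λ t → t + sumF (λ j → g (suc j) * simple i j)) (ℤ.*-zeroʳ (g zero)))
        (trans (ℤ.+-identityˡ _) (sumF-simple (g ∘ suc) i))

module Reflection {n : ℕ} (C : CartanMatrix n) (i : Fin n) where
  open CartanMatrix C

  s : Vect n → Vect n
  s = refl' C i

  RootsAreSigned : Set
  RootsAreSigned = ∀ β → IsRoot C β → IsPositive C β ⊎ IsNegative C β

  eval-cong : ∀ f {x y : Vect n} → x ≈ y → eval C f x ≡ eval C f y
  eval-cong f x≈y = sumF-cong (λ j → cong (f j *_) (x≈y j))

  eval-linear : ∀ f a b (x y : Vect n) →
                eval C f (λ j → a * x j + b * y j) ≡ a * eval C f x + b * eval C f y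
  eval-linear f a b x y =
    trans (sumF-cong (λ j → distrib (f j) a b (x j) (y j)))
          (sumF-linear a b (λ j → f j * x j) (λ j → f j * y j))
    where
    distrib : ∀ c a b x y → c * (a * x + b * y) ≡ a * (c * x) + b * (c * y)
    distrib = solve-∀

  eval-simple : ∀ f → eval C f (simple i) ≡ f i
  eval-simple f = sumF-simple f i

  -- pairing C i is eval C (A i) definitionally.
  pairing-simple : pairing C i (simple i) ≡ + 2
  pairing-simple = trans (eval-simple (A i)) (diag i)

  s-cong : ∀ {x y : Vect n} → x ≈ y → s x ≈ s y
  s-cong x≈y j = cong₂ _-_ (x≈y j) (cong (_* simple i j) (eval-cong (A i) x≈y))

  s-offdiag : ∀ x {j} → i ≢ j → s x j ≡ x j
  s-offdiag x {j} i≢j = begin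
    x j - pairing C i x * simple i j ≡⟨ cong (λ e → x j - pairing C i x * e) (simple-offdiag i≢j) ⟩
    x j - pairing C i x * 0ℤ          ≡⟨ cong (λ e → x j - e) (ℤ.*-zeroʳ (pairing C i x)) ⟩
    x j + 0ℤ                          ≡⟨ ℤ.+-identityʳ (x j) ⟩
    x j                               ∎
    where open ≡-Reasoning

  s-linear : ∀ a b (x y : Vect n) → s (λ j → a * x j + b * y j) ≈ (λ j → a * s x j + b * s y j)
  s-linear a b x y j =
    trans (cong (λ p → (a * x j + b * y j) - p * simple i j) (eval-linear (A i) a b x y))
          (distrib a b (x j) (y j) (pairing C i x) (pairing C i y) (simple i j))
    where
    distrib : ∀ a b x y p q e →
              (a * x + b * y) - (a * p + b * q) * e ≡ a * (x - p * e) + b * (y - q * e)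
    distrib = solve-∀

  s-scale : ∀ c x → s (λ j → c * x j) ≈ (λ j → c * s x j)
  s-scale c x j = begin
    s (λ k → c * x k) j                ≡⟨ s-cong (λ k → sym (add-zero c (x k))) j ⟩
    s (λ k → c * x k + 0ℤ * x k) j     ≡⟨ s-linear c 0ℤ x x j ⟩
    c * s x j + 0ℤ * s x j             ≡⟨ add-zero c (s x j) ⟩
    c * s x j                          ∎
    where
    open ≡-Reasoning
    add-zero : ∀ c y → c * y + 0ℤ * y ≡ c * y
    add-zero c y = ℤ.+-identityʳ (c * y)

  s-as-combination : ∀ x → s x ≈ (λ j → + 1 * x j + (- pairing C i x) * simple i j)
  s-as-combination x j = rearrange (x j) (pairing C i x) (simple i j)
    where
    rearrange : ∀ x p e → x - p * e ≡ + 1 * x + (- p) * e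
    rearrange = solve-∀

  pairing-s : ∀ x → pairing C i (s x) ≡ - pairing C i x
  pairing-s x = begin
    pairing C i (s x)                          ≡⟨ eval-cong (A i) (s-as-combination x) ⟩
    pairing C i (λ j → + 1 * x j + (- p) * simple i j)
                                               ≡⟨ eval-linear (A i) (+ 1) (- p) x (simple i) ⟩
    + 1 * p + (- p) * pairing C i (simple i)   ≡⟨ cong (λ q → + 1 * p + (- p) * q) pairing-simple ⟩
    + 1 * p + (- p) * + 2                      ≡⟨ simplify p ⟩
    - p                                        ∎
    where
    open ≡-Reasoning
    p = pairing C i x
    simplify : ∀ p → + 1 * p + (- p) * + 2 ≡ - p
    simplify = solve-∀

  s-involutive : ∀ x → s (s x) ≈ x
  s-involutive x j =
    trans (cong (λ q → s x j - q * simple i j) (pairing-s x))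
          (cancel (x j) (pairing C i x) (simple i j))
    where
    cancel : ∀ x p e → (x - p * e) - (- p) * e ≡ x
    cancel = solve-∀

  s-flip : ∀ {x y} → s x ≈ y → x ≈ s y
  s-flip {x} sx≈y j = trans (sym (s-involutive x j)) (s-cong sx≈y j)

  s-simple : s (simple i) ≈ (λ j → - simple i j)
  s-simple j =
    trans (cong (λ q → simple i j - q * simple i j) pairing-simple) (negate (simple i j))
    where
    negate : ∀ e → e - + 2 * e ≡ - e
    negate = solve-∀

  s-fixes-zero : ∀ {x} → (∀ j → x j ≡ 0ℤ) → s x ≈ x
  s-fixes-zero {x} x≗0 j = begin
    x j - pairing C i x * simple i j ≡⟨ cong (λ p → x j - p * simple i j)
                                             (sumF-zero (λ k → trans (cong (A i k *_) (x≗0 k))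
                                                                     (ℤ.*-zeroʳ (A i k)))) ⟩
    x j + 0ℤ                          ≡⟨ ℤ.+-identityʳ (x j) ⟩
    x j                               ∎
    where open ≡-Reasoning

  -- The contragredient action of s_i on V*, in dual coordinates.
  coreflect : Vect n → Vect n
  coreflect f j = f j - f i * A i j

  eval-coreflect : ∀ f x → eval C (coreflect f) x ≡ eval C f (s x)
  eval-coreflect f x = begin
    eval C (coreflect f) x                       ≡⟨ sumF-cong (λ j → expand (f j) (f i) (A i j) (x j)) ⟩
    sumF (λ j → + 1 * (f j * x j) + (- f i) * (A i j * x j))
                                                 ≡⟨ sumF-linear (+ 1) (- f i) (λ j → f j * x j) (λ j → A i j * x j) ⟩
    + 1 * eval C f x + (- f i) * pairing C i x   ≡⟨ cong (_+_ (+ 1 * eval C f x)) (swap (f i) (pairing C i x)) ⟩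
    + 1 * eval C f x + (- pairing C i x) * f i   ≡⟨ cong (λ q → + 1 * eval C f x + (- pairing C i x) * q)
                                                         (eval-simple f) ⟨
    + 1 * eval C f x + (- pairing C i x) * eval C f (simple i)
                                                 ≡⟨ eval-linear f (+ 1) (- pairing C i x) x (simple i) ⟨
    eval C f (λ j → + 1 * x j + (- pairing C i x) * simple i j)
                                                 ≡⟨ eval-cong f (s-as-combination x) ⟨
    eval C f (s x)                               ∎
    where
    open ≡-Reasoning
    expand : ∀ f g a x → (f - g * a) * x ≡ + 1 * (f * x) + (- g) * (a * x)
    expand = solve-∀
    swap : ∀ a b → (- a) * b ≡ (- b) * a
    swap = solve-∀

  simple-isRoot : IsRoot C (simple i)
  simple-isRoot = [] , i , λ _ → refl

  isRoot-s : ∀ {x} → IsRoot C x → IsRoot C (s x)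
  isRoot-s (w , k , act≈x) = i ∷ w , k , s-cong act≈x

  -- s_i fixes every coordinate but the i-th, so a positive x with s_i x ≤ 0 lives on α_i.
  concentrated : ∀ {x} → IsPositive C x → IsNegative C (s x) → ∀ j → x j ≡ x i * simple i j
  concentrated {x} pos sneg j with i Fin.≟ j
  ... | yes refl = sym (trans (cong (x i *_) (simple-diag i)) (ℤ.*-identityʳ (x i)))
  ... | no i≢j   = trans (ℤ.≤-antisym (subst (_≤ 0ℤ) (s-offdiag x i≢j) (sneg j)) (pos j))
                         (sym (trans (cong (x i *_) (simple-offdiag i≢j)) (ℤ.*-zeroʳ (x i))))

  inSpan-resp : ∀ {u u' v v' x} → u ≈ u' → v ≈ v' → InSpan C u v x → InSpan C u' v' x
  inSpan-resp u≈u' v≈v' (c , a , b , c≢0 , cx≡) =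
    c , a , b , c≢0 , λ j → trans (cx≡ j) (cong₂ (λ p q → a * p + b * q) (u≈u' j) (v≈v' j))

  inSpan-negate : ∀ {u v x y} → (∀ j → y j ≡ - x j) → InSpan C u v y → InSpan C u v x
  inSpan-negate {x = x} {y} y≡-x (c , a , b , c≢0 , cy≡) =
    - c , a , b , -c≢0 , λ j → trans (move-neg c (x j)) (trans (cong (c *_) (sym (y≡-x j))) (cy≡ j))
    where
    -c≢0 : - c ≢ 0ℤ
    -c≢0 -c≡0 = c≢0 (trans (sym (ℤ.neg-involutive c)) (cong -_ -c≡0))
    move-neg : ∀ c e → (- c) * e ≡ c * (- e)
    move-neg = solve-∀

  inSpan-multiple : ∀ {u v x} → InSpan C u v x → (∀ j → x j ≡ x i * simple i j) → x i ≢ 0ℤ →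
                    InSpan C u v (simple i)
  inSpan-multiple {x = x} (c , a , b , c≢0 , cx≡) x≡ xi≢0 =
    c * x i , a , b , cxi≢0 ,
    λ j → trans (ℤ.*-assoc c (x i) (simple i j)) (trans (cong (c *_) (sym (x≡ j))) (cx≡ j))
    where
    cxi≢0 : c * x i ≢ 0ℤ
    cxi≢0 cxi≡0 = Sum.[ c≢0 , xi≢0 ] (ℤ.i*j≡0⇒i≡0∨j≡0 c cxi≡0)

  inSpan-s : ∀ {u v x} → InSpan C u v x → InSpan C (s u) (s v) (s x)
  inSpan-s {u} {v} {x} (c , a , b , c≢0 , cx≡) = c , a , b , c≢0 , λ j → begin
    c * s x j                          ≡⟨ s-scale c x j ⟨
    s (λ k → c * x k) j                ≡⟨ s-cong cx≡ j ⟩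
    s (λ k → a * u k + b * v k) j      ≡⟨ s-linear a b u v j ⟩
    a * s u j + b * s v j              ∎
    where open ≡-Reasoning

  inSub-resp : ∀ {u u' v v' x} → u ≈ u' → v ≈ v' → InSub C u v x → InSub C u' v' x
  inSub-resp u≈u' v≈v' (root , span) = root , inSpan-resp u≈u' v≈v' span

  inSub-s : ∀ {u v x} → InSub C u v x → InSub C (s u) (s v) (s x)
  inSub-s (root , span) = isRoot-s root , inSpan-s span

  inSub-s⁻¹ : ∀ {u v x} → InSub C (s u) (s v) x → InSub C u v (s x)
  inSub-s⁻¹ {u} {v} = inSub-resp (s-involutive u) (s-involutive v) ∘ inSub-s

  simple-∉-s : ∀ {u v} → ¬ InSub C u v (simple i) → ¬ InSub C (s u) (s v) (simple i)
  simple-∉-s {u} {v} α∉ α∈ =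
    α∉ (simple-isRoot , inSpan-negate s-simple (proj₂ (inSub-s⁻¹ {u} {v} {simple i} α∈)))

  isPositive-s : RootsAreSigned → ∀ {u v x} → ¬ InSub C u v (simple i) →
                 InSub C u v x → IsPositive C x → IsPositive C (s x)
  isPositive-s signed {x = x} α∉ (root , span) pos with signed (s x) (isRoot-s root)
  ... | inj₁ spos = spos
  ... | inj₂ sneg with x i ℤ.≟ 0ℤ
  ...   | yes xi≡0 = λ j → subst (0ℤ ≤_) (sym (s-fixes-zero x≗0 j)) (pos j)
    where
    x≗0 : ∀ j → x j ≡ 0ℤ
    x≗0 j = trans (concentrated pos sneg j) (cong (_* simple i j) xi≡0)
  ...   | no xi≢0 = ⊥-elim (α∉ (simple-isRoot , inSpan-multiple span (concentrated pos sneg) xi≢0))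

  isFundamental-resp : ∀ {u u' v v' γ} → u ≈ u' → v ≈ v' →
                       IsFundamental C u v γ → IsFundamental C u' v' γ
  isFundamental-resp u≈u' v≈v' (sub , pos , f , fγ≡0 , f>0) =
    inSub-resp u≈u' v≈v' sub , pos , f , fγ≡0 ,
    λ ε sub' → f>0 ε (inSub-resp (λ j → sym (u≈u' j)) (λ j → sym (v≈v' j)) sub')

  isFundamental-s : RootsAreSigned → ∀ {u v γ} → ¬ InSub C u v (simple i) →
                    IsFundamental C u v γ → IsFundamental C (s u) (s v) (s γ)
  isFundamental-s signed {γ = γ} α∉ (sub , pos , f , fγ≡0 , f>0) =
    inSub-s sub , isPositive-s signed α∉ sub pos , coreflect f ,
    trans (eval-coreflect f (s γ)) (trans (eval-cong f (s-involutive γ)) fγ≡0) ,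
    λ ε subε posε ε≉sγ →
      subst (0ℤ <_) (sym (eval-coreflect f ε))
            (f>0 (s ε) (inSub-s⁻¹ subε) (isPositive-s signed (simple-∉-s α∉) subε posε)
                 (ε≉sγ ∘ s-flip))

  isFundamental-s⁻¹ : RootsAreSigned → ∀ {u v ε} → ¬ InSub C u v (simple i) →
                      IsFundamental C (s u) (s v) ε → IsFundamental C u v (s ε)
  isFundamental-s⁻¹ signed {u} {v} α∉ =
    isFundamental-resp (s-involutive u) (s-involutive v) ∘ isFundamental-s signed (simple-∉-s α∉)

lemma4p2 : ∀ {n : ℕ} (C : CartanMatrix n) →
    (∀ β → IsRoot C β → IsPositive C β ⊎ IsNegative C β) →
    ∀ (i : Fin n) (β₁ β₂ : Vect n) →
    IsRoot C β₁ → IsRoot C β₂ → LinIndep C β₁ β₂ →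
    ¬ InSub C β₁ β₂ (simple i) →
    ∀ (γ δ : Vect n) → ¬ (γ ≈ δ) →
    (∀ ε → IsFundamental C β₁ β₂ ε → (ε ≈ γ) ⊎ (ε ≈ δ)) →
    IsFundamental C β₁ β₂ γ → IsFundamental C β₁ β₂ δ →
    (∀ ε → IsFundamental C (refl' C i β₁) (refl' C i β₂) ε →
        (ε ≈ refl' C i γ) ⊎ (ε ≈ refl' C i δ))
    × IsFundamental C (refl' C i β₁) (refl' C i β₂) (refl' C i γ)
    × IsFundamental C (refl' C i β₁) (refl' C i β₂) (refl' C i δ)
lemma4p2 C signed i β₁ β₂ _ _ _ α∉R γ δ _ onlyγδ fγ fδ =
  only , isFundamental-s signed α∉R fγ , isFundamental-s signed α∉R fδ
  where
  open Reflection C i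
  only : ∀ ε → IsFundamental C (s β₁) (s β₂) ε → (ε ≈ s γ) ⊎ (ε ≈ s δ)
  only ε fε = Sum.map s-flip s-flip (onlyγδ (s ε) (isFundamental-s⁻¹ signed α∉R fε))
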